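{- Let $c$ be a $3$-coloring of the nonzero rational numbers with no monochromatic solution to $x_0+\tfrac{3}{2}x_1=\tfrac{9}{4}x_2$. If $c(x)\neq c(2x)$ for every nonzero rational number $x$, then for every nonzero rational number $y$ and integers $m,n,p$, $c(2^m3^n5^py)=c(y)$ holds if and only if $m$ is a multiple of $3$.
   Context: A solution is a triple of nonzero rationals (not necessarily distinct) satisfying the equation; it is monochromatic if all entries have the same color. -}

module Defs where

open import Data.Nat as ℕ using (ℕ; suc)
open import Data.Integer as ℤ using (ℤ; +_; -[1+_])
open import Data.Rational using (ℚ; _/_; _*_; _+_; 0ℚ)
open import Data.Fin using (Fin)
import Data.Nat.Properties as ℕP
open import Data.Product using (_×_)
open import Relation.Binary.PropositionalEquality using (_≡_; _≢_)
open import Relation.Nullary using (¬_)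

-- b ^ k as a rational, for a positive natural base b = suc b' and integer exponent k
-- (negative exponents give 1 / b^|k|).
zpow : (b' : ℕ) → ℤ → ℚ
zpow b' (+ n)     = (+ (suc b' ℕ.^ n)) / 1
zpow b' -[1+ n ]  = _/_ (+ 1) (suc b' ℕ.^ suc n) ⦃ ℕP.m^n≢0 (suc b') (suc n) ⦄

-- A 3-colouring of the nonzero rationals; its values at 0 are irrelevant
-- (all hypotheses/conclusions below only ever evaluate it at nonzero rationals).
Colouring : Set
Colouring = ℚ → Fin 3

three/two : ℚ
three/two = (+ 3) / 2

nine/four : ℚ
nine/four = (+ 9) / 4

MonoSol : Colouring → ℚ → ℚ → ℚ → Set
MonoSol c x₀ x₁ x₂ =
  x₀ ≢ 0ℚ × x₁ ≢ 0ℚ × x₂ ≢ 0ℚ ×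
  (x₀ + three/two * x₁ ≡ nine/four * x₂) ×
  c x₀ ≡ c x₁ × c x₁ ≡ c x₂

NoMonoSol : Colouring → Set
NoMonoSol c = ∀ x₀ x₁ x₂ → ¬ MonoSol c x₀ x₁ x₂

-- The colour facts c x ≢ c (4x), c (3x) ≡ c x and c (5x) ≡ c x each follow from a finite
-- refutation: a case split on the colours of finitely many multiples q x, propagated through
-- instances of the equation and of c x ≢ c (2x) among them, checked by evaluation.  Then x, 2x
-- and 4x carry three different colours, so c (8x) ≡ c x; hence the colour of 2^m 3^n 5^p y
-- depends only on m mod 3, and is c y exactly when 3 ∣ m.

module Submission where

open import Defs
open import Data.Integer using (ℤ; +_)
open import Data.Integer.Divisibility using (_∣_)
open import Data.Rational using (ℚ; _*_; 0ℚ; 1ℚ; _/_)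
open import Data.Product using (_×_)
open import Function.Bundles using (_⇔_)
open import Relation.Binary.PropositionalEquality using (_≡_; _≢_)

open import Data.Bool as Bool using (Bool; T; _∧_)
open import Data.Bool.Properties using (T-∧)
open import Data.Empty using (⊥; ⊥-elim)
open import Data.Fin as Fin using (Fin; punchIn; _≟_)
open import Data.Fin.Patterns using (0F; 1F; 2F)
import Data.Fin.Properties as Fin
open import Data.Integer as ℤ using (-[1+_])
import Data.Integer.Properties as ℤ
open import Data.List using (List; []; _∷_; head; drop)
open import Data.List.Relation.Unary.All as All using (All; []; _∷_; all?)
open import Data.Maybe using (just; nothing; fromMaybe)
open import Data.Nat as ℕ using (ℕ; zero; suc)
import Data.Nat.Divisibility as ℕ
import Data.Nat.Properties as ℕ
open import Data.Product using (_,_)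
import Data.Product.Properties as Product
open import Data.List.Membership.DecPropositional (Product.≡-dec ℕ._≟_ (_≟_ {3})) using (_∈?_)
open import Data.Rational using (_+_; 1/_; toℚᵘ; ≢-nonZero)
import Data.Rational.Properties as ℚ
import Data.Rational.Unnormalised as ℚᵘ
import Data.Rational.Unnormalised.Properties as ℚᵘ
open import Function using (id; _∘_)
open import Function.Bundles using (Equivalence; mk⇔)
open import Function.Related.Propositional using (module EquationalReasoning)
open import Relation.Binary.PropositionalEquality using (refl; sym; trans; cong; ≢-sym; module ≡-Reasoning)
open import Relation.Nullary using (¬_; Dec; no)
open import Relation.Nullary.Decidable using (isYes; toWitness; decidable-stable; from-no; _×-dec_; ¬?; _→-dec_)

-- Integer powers in ℚ

-- (+ k) / suc d is definitionally fromℚᵘ (mkℚᵘ (+ k) d), which is what toℚᵘ-fromℚᵘ unfolds.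
/1-homo-* : ∀ m n → (+ (m ℕ.* n)) / 1 ≡ ((+ m) / 1) * ((+ n) / 1)
/1-homo-* m n = ℚ.toℚᵘ-injective (begin
    toℚᵘ ((+ (m ℕ.* n)) / 1)               ≈⟨ ℚ.toℚᵘ-fromℚᵘ mn′ ⟩
    mn′                                    ≈⟨ ℚᵘ.*≡* (cong (ℤ._* (+ 1)) (ℤ.pos-* m n)) ⟩
    m′ ℚᵘ.* n′                             ≈⟨ ℚᵘ.*-cong (ℚ.toℚᵘ-fromℚᵘ m′) (ℚ.toℚᵘ-fromℚᵘ n′) ⟨
    toℚᵘ ((+ m) / 1) ℚᵘ.* toℚᵘ ((+ n) / 1) ≈⟨ ℚ.toℚᵘ-homo-* ((+ m) / 1) ((+ n) / 1) ⟨
    toℚᵘ (((+ m) / 1) * ((+ n) / 1))       ∎)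
  where
    open ℚᵘ.≃-Reasoning
    m′ = ℚᵘ.mkℚᵘ (+ m) 0
    n′ = ℚᵘ.mkℚᵘ (+ n) 0
    mn′ = ℚᵘ.mkℚᵘ (+ (m ℕ.* n)) 0

n/1*1/n≡1 : ∀ n .{{_ : ℕ.NonZero n}} → ((+ n) / 1) * ((+ 1) / n) ≡ 1ℚ
n/1*1/n≡1 n@(suc _) = ℚ.toℚᵘ-injective (begin
    toℚᵘ (((+ n) / 1) * ((+ 1) / n))       ≈⟨ ℚ.toℚᵘ-homo-* ((+ n) / 1) ((+ 1) / n) ⟩
    toℚᵘ ((+ n) / 1) ℚᵘ.* toℚᵘ ((+ 1) / n) ≈⟨ ℚᵘ.*-cong (ℚ.toℚᵘ-fromℚᵘ n′) (ℚ.toℚᵘ-fromℚᵘ (ℚᵘ.1/ n′)) ⟩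
    n′ ℚᵘ.* ℚᵘ.1/ n′                       ≈⟨ ℚᵘ.*-inverseʳ n′ ⟩
    ℚᵘ.1ℚᵘ                                 ∎)
  where
    open ℚᵘ.≃-Reasoning
    n′ = ℚᵘ.mkℚᵘ (+ n) 0

p*q≡1⇒p≢0 : ∀ p q → p * q ≡ 1ℚ → p ≢ 0ℚ
p*q≡1⇒p≢0 p q pq≡1 refl = ℚ.1≢0 (trans (sym pq≡1) (ℚ.*-zeroˡ q))

p*q≡1⇒q≢0 : ∀ p q → p * q ≡ 1ℚ → q ≢ 0ℚ
p*q≡1⇒q≢0 p q pq≡1 refl = ℚ.1≢0 (trans (sym pq≡1) (ℚ.*-zeroʳ p))

*-≢0 : ∀ {p q} → p ≢ 0ℚ → q ≢ 0ℚ → p * q ≢ 0ℚ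
*-≢0 {p} {q} p≢0 q≢0 pq≡0 = q≢0 (begin
    q                ≡⟨ ℚ.*-identityˡ q ⟨
    1ℚ * q           ≡⟨ cong (_* q) (ℚ.*-inverseˡ p) ⟨
    (1/ p) * p * q   ≡⟨ ℚ.*-assoc (1/ p) p q ⟩
    (1/ p) * (p * q) ≡⟨ cong (1/ p *_) pq≡0 ⟩
    (1/ p) * 0ℚ      ≡⟨ ℚ.*-zeroʳ (1/ p) ⟩
    0ℚ               ∎)
  where
    open ≡-Reasoning
    instance _ = ≢-nonZero p≢0

zpow-+ : ∀ b m n → zpow b (+ (m ℕ.+ n)) ≡ zpow b (+ m) * zpow b (+ n)
zpow-+ b m n =
  trans (cong (λ k → (+ k) / 1) (ℕ.^-distribˡ-+-* (suc b) m n)) (/1-homo-* (suc b ℕ.^ m) (suc b ℕ.^ n))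

zpow-inverse : ∀ b n → zpow b (+ suc n) * zpow b -[1+ n ] ≡ 1ℚ
zpow-inverse b n = n/1*1/n≡1 (suc b ℕ.^ suc n) {{ℕ.m^n≢0 (suc b) (suc n)}}

zpow≢0 : ∀ b k → zpow b k ≢ 0ℚ
zpow≢0 b (+ zero)  = λ ()
zpow≢0 b (+ suc n) = p*q≡1⇒p≢0 _ (zpow b -[1+ n ]) (zpow-inverse b n)
zpow≢0 b -[1+ n ]  = p*q≡1⇒q≢0 (zpow b (+ suc n)) _ (zpow-inverse b n)

zpow-+-* : ∀ b m n x → zpow b (+ (m ℕ.+ n)) * x ≡ zpow b (+ m) * (zpow b (+ n) * x)
zpow-+-* b m n x = trans (cong (_* x) (zpow-+ b m n)) (ℚ.*-assoc (zpow b (+ m)) (zpow b (+ n)) x)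

zpow-cancel : ∀ b n x → zpow b (+ suc n) * (zpow b -[1+ n ] * x) ≡ x
zpow-cancel b n x = begin
    zpow b (+ suc n) * (zpow b -[1+ n ] * x) ≡⟨ ℚ.*-assoc (zpow b (+ suc n)) (zpow b -[1+ n ]) x ⟨
    zpow b (+ suc n) * zpow b -[1+ n ] * x   ≡⟨ cong (_* x) (zpow-inverse b n) ⟩
    1ℚ * x                                   ≡⟨ ℚ.*-identityˡ x ⟩
    x                                        ∎
  where open ≡-Reasoning

-- Functions invariant under scaling

≡-cong-⇔ : ∀ {A : Set} {a a′ b b′ : A} → a ≡ a′ → b ≡ b′ → (a ≡ b) ⇔ (a′ ≡ b′)
≡-cong-⇔ refl refl = mk⇔ id id

≡-sym-⇔ : ∀ {A : Set} {a b : A} → (a ≡ b) ⇔ (b ≡ a)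
≡-sym-⇔ = mk⇔ sym sym

module _ {A : Set} (g : ℚ → A) (b : ℕ)
         (g-invariant : ∀ x → x ≢ 0ℚ → g (zpow b (+ 1) * x) ≡ g x) where

  ℕ-zpow-invariant : ∀ n x → x ≢ 0ℚ → g (zpow b (+ n) * x) ≡ g x
  ℕ-zpow-invariant zero    x x≢0 = cong g (ℚ.*-identityˡ x)
  ℕ-zpow-invariant (suc n) x x≢0 = begin
    g (zpow b (+ (1 ℕ.+ n)) * x)          ≡⟨ cong g (zpow-+-* b 1 n x) ⟩
    g (zpow b (+ 1) * (zpow b (+ n) * x)) ≡⟨ g-invariant _ (*-≢0 (zpow≢0 b (+ n)) x≢0) ⟩
    g (zpow b (+ n) * x)                  ≡⟨ ℕ-zpow-invariant n x x≢0 ⟩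
    g x                                   ∎
    where open ≡-Reasoning

  zpow-invariant : ∀ k x → x ≢ 0ℚ → g (zpow b k * x) ≡ g x
  zpow-invariant (+ n)    x x≢0 = ℕ-zpow-invariant n x x≢0
  zpow-invariant -[1+ n ] x x≢0 = begin
    g (zpow b -[1+ n ] * x)                      ≡⟨ ℕ-zpow-invariant (suc n) _ (*-≢0 (zpow≢0 b -[1+ n ]) x≢0) ⟨
    g (zpow b (+ suc n) * (zpow b -[1+ n ] * x)) ≡⟨ cong g (zpow-cancel b n x) ⟩
    g x                                          ∎
    where open ≡-Reasoning

3∤1 : ¬ 3 ℕ.∣ 1
3∤1 = from-no (3 ℕ.∣? 1)

3∤2 : ¬ 3 ℕ.∣ 2
3∤2 = from-no (3 ℕ.∣? 2)

3∣n⇔3∣3+n : ∀ n → 3 ℕ.∣ n ⇔ 3 ℕ.∣ 3 ℕ.+ n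
3∣n⇔3∣3+n n = mk⇔ (ℕ.∣m∣n⇒∣m+n ℕ.∣-refl) (λ 3∣3+n → ℕ.∣m+n∣m⇒∣n 3∣3+n ℕ.∣-refl)

module _ {A : Set} (g : ℚ → A)
         (g≢g2 : ∀ x → x ≢ 0ℚ → g x ≢ g ((+ 2) / 1 * x))
         (g≢g4 : ∀ x → x ≢ 0ℚ → g x ≢ g ((+ 4) / 1 * x))
         (g8≡g : ∀ x → x ≢ 0ℚ → g ((+ 8) / 1 * x) ≡ g x) where

  ℕ-powers-of-two : ∀ n x → x ≢ 0ℚ → (g (zpow 1 (+ n) * x) ≡ g x) ⇔ (3 ℕ.∣ n)
  ℕ-powers-of-two 0 x x≢0 = mk⇔ (λ _ → 3 ℕ.∣0) (λ _ → cong g (ℚ.*-identityˡ x))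
  ℕ-powers-of-two 1 x x≢0 = mk⇔ (λ e → ⊥-elim (g≢g2 x x≢0 (sym e))) (⊥-elim ∘ 3∤1)
  ℕ-powers-of-two 2 x x≢0 = mk⇔ (λ e → ⊥-elim (g≢g4 x x≢0 (sym e))) (⊥-elim ∘ 3∤2)
  ℕ-powers-of-two (suc (suc (suc n))) x x≢0 = begin
    g (zpow 1 (+ (3 ℕ.+ n)) * x) ≡ g x ∼⟨ ≡-cong-⇔ period refl ⟩
    g (zpow 1 (+ n) * x) ≡ g x         ∼⟨ ℕ-powers-of-two n x x≢0 ⟩
    3 ℕ.∣ n                            ∼⟨ 3∣n⇔3∣3+n n ⟩
    3 ℕ.∣ 3 ℕ.+ n                      ∎
    where
      open EquationalReasoning
      period : g (zpow 1 (+ (3 ℕ.+ n)) * x) ≡ g (zpow 1 (+ n) * x)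
      period = trans (cong g (zpow-+-* 1 3 n x)) (g8≡g _ (*-≢0 (zpow≢0 1 (+ n)) x≢0))

  powers-of-two : ∀ m x → x ≢ 0ℚ → (g (zpow 1 m * x) ≡ g x) ⇔ (+ 3 ∣ m)
  powers-of-two (+ n)    x x≢0 = ℕ-powers-of-two n x x≢0
  powers-of-two -[1+ n ] x x≢0 = begin
    g q ≡ g x                           ∼⟨ ≡-sym-⇔ ⟩
    g x ≡ g q                           ∼⟨ ≡-cong-⇔ (cong g (sym (zpow-cancel 1 n x))) refl ⟩
    g (zpow 1 (+ suc n) * q) ≡ g q      ∼⟨ ℕ-powers-of-two (suc n) q (*-≢0 (zpow≢0 1 -[1+ n ]) x≢0) ⟩
    3 ℕ.∣ suc n                         ≡⟨⟩
    + 3 ∣ -[1+ n ]                      ∎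
    where
      open EquationalReasoning
      q = zpow 1 -[1+ n ] * x

-- Refutations of partial 3-colourings

T-∧⁻ : ∀ a {b} → T (a ∧ b) → T a × T b
T-∧⁻ _ = Equivalence.to T-∧

T-∧³⁻ : ∀ a b {c} → T (a ∧ b ∧ c) → T a × T b × T c
T-∧³⁻ a b h = let ha , hbc = T-∧⁻ a h in ha , T-∧⁻ b hbc

colour-forced : ∀ (v k : Fin 3) → v ≢ punchIn k 0F → v ≢ punchIn k 1F → v ≡ k
colour-forced = toWitness {a? = Fin.all? λ v → Fin.all? λ k →
  ¬? (v ≟ punchIn k 0F) →-dec ¬? (v ≟ punchIn k 1F) →-dec v ≟ k} _

≡-all : ∀ {A : Set} {a b d k : A} → a ≡ k → b ≡ k → d ≡ k → a ≡ b × b ≡ d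
≡-all refl refl refl = refl , refl

last-colour : ∀ {u v w z : Fin 3} → u ≢ v → v ≢ w → w ≢ u → z ≢ v → z ≢ w → z ≡ u
last-colour {u} {v} {w} {z} = toWitness {a? = Fin.all? λ u → Fin.all? λ v → Fin.all? λ w → Fin.all? λ z →
  ¬? (u ≟ v) →-dec ¬? (v ≟ w) →-dec ¬? (w ≟ u) →-dec ¬? (z ≟ v) →-dec ¬? (z ≟ w) →-dec z ≟ u} _ u v w z

data Constraint : Set where
  distinct : ℕ → ℕ → Constraint
  same     : ℕ → ℕ → Constraint
  notMono  : ℕ → ℕ → ℕ → Constraint

Holds : (ℕ → Fin 3) → Constraint → Set
Holds f (distinct i j)  = f i ≢ f j
Holds f (same i j)      = f i ≡ f j
Holds f (notMono i j l) = ¬ (f i ≡ f j × f j ≡ f l)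

-- (i , k) records that point i does not have colour k.
Exclusion : Set
Exclusion = ℕ × Fin 3

excludes? : List Exclusion → ℕ → Fin 3 → Bool
excludes? E i k = isYes ((i , k) ∈? E)

forces? : List Exclusion → ℕ → Fin 3 → Bool
forces? E i k = excludes? E i (punchIn k 0F) ∧ excludes? E i (punchIn k 1F)

assume : ℕ → Fin 3 → List Exclusion → List Exclusion
assume i k E = (i , punchIn k 0F) ∷ (i , punchIn k 1F) ∷ E

target : Constraint → Fin 3 → ℕ
target (distinct i j)  0F = i
target (distinct i j)  _  = j
target (same i j)      0F = i
target (same i j)      _  = j
target (notMono i j l) 0F = i
target (notMono i j l) 1F = j
target (notMono i j l) 2F = l

premises? : List Exclusion → Constraint → Fin 3 → Fin 3 → Bool
premises? E (distinct i j)  k 0F = forces? E j k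
premises? E (distinct i j)  k _  = forces? E i k
premises? E (same i j)      k 0F = excludes? E j k
premises? E (same i j)      k _  = excludes? E i k
premises? E (notMono i j l) k 0F = forces? E j k ∧ forces? E l k
premises? E (notMono i j l) k 1F = forces? E i k ∧ forces? E l k
premises? E (notMono i j l) k 2F = forces? E i k ∧ forces? E j k

data Step : Set where
  derive : ℕ → Fin 3 → Fin 3 → Step

-- split i r₀ r₁ r₂ branches on the colour of point i; derive n k v uses the n-th constraint
-- to exclude colour k at its v-th point; close i ends a branch where all colours of i are excluded.
infixr 5 _▸_
data Refutation : Set where
  split : ℕ → Refutation → Refutation → Refutation → Refutation
  _▸_   : Step → Refutation → Refutation
  close : ℕ → Refutation

refutes : List Constraint → List Exclusion → Refutation → Bool
refutes Cs E (split i r₀ r₁ r₂) =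
  refutes Cs (assume i 0F E) r₀ ∧ refutes Cs (assume i 1F E) r₁ ∧ refutes Cs (assume i 2F E) r₂
refutes Cs E (derive n k v ▸ r) with head (drop n Cs)
... | nothing  = Bool.false
... | just con = premises? E con k v ∧ refutes Cs ((target con v , k) ∷ E) r
refutes Cs E (close i) = excludes? E i 0F ∧ forces? E i 0F

All-head-drop : ∀ {A : Set} {P : A → Set} {xs x} n → All P xs → head (drop n xs) ≡ just x → P x
All-head-drop zero    (px ∷ _)  refl = px
All-head-drop (suc n) (_ ∷ ps)  eq   = All-head-drop n ps eq

module _ (f : ℕ → Fin 3) where

  Excludes : Exclusion → Set
  Excludes (i , k) = f i ≢ k

  excludes-sound : ∀ {E} → All Excludes E → ∀ i k → T (excludes? E i k) → f i ≢ k
  excludes-sound {E} es i k h = All.lookup es (toWitness {a? = (i , k) ∈? E} h)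

  forces-sound : ∀ {E} → All Excludes E → ∀ i k → T (forces? E i k) → f i ≡ k
  forces-sound {E} es i k h = let h₀ , h₁ = T-∧⁻ (excludes? E i (punchIn k 0F)) h in
    colour-forced (f i) k (excludes-sound es i _ h₀) (excludes-sound es i _ h₁)

  forces²-sound : ∀ {E} → All Excludes E → ∀ i j k → T (forces? E i k ∧ forces? E j k) →
                  f i ≡ k × f j ≡ k
  forces²-sound {E} es i j k h = let hi , hj = T-∧⁻ (forces? E i k) h in
    forces-sound es i k hi , forces-sound es j k hj

  assume-sound : ∀ {E i k} → f i ≡ k → All Excludes E → All Excludes (assume i k E)
  assume-sound {k = k} refl es = (Fin.punchInᵢ≢i k 0F ∘ sym) ∷ (Fin.punchInᵢ≢i k 1F ∘ sym) ∷ es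

  derive-sound : ∀ {E} → All Excludes E → ∀ con k v → Holds f con → T (premises? E con k v) →
                 f (target con v) ≢ k
  derive-sound es (distinct i j) k 0F fi≢fj h fi≡k = fi≢fj (trans fi≡k (sym (forces-sound es j k h)))
  derive-sound es (distinct i j) k (Fin.suc _) fi≢fj h fj≡k =
    fi≢fj (trans (forces-sound es i k h) (sym fj≡k))
  derive-sound es (same i j) k 0F fi≡fj h fi≡k = excludes-sound es j k h (trans (sym fi≡fj) fi≡k)
  derive-sound es (same i j) k (Fin.suc _) fi≡fj h fj≡k = excludes-sound es i k h (trans fi≡fj fj≡k)
  derive-sound es (notMono i j l) k 0F ¬mono h fi≡k =
    let fj≡k , fl≡k = forces²-sound es j l k h in ¬mono (≡-all fi≡k fj≡k fl≡k)
  derive-sound es (notMono i j l) k 1F ¬mono h fj≡k =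
    let fi≡k , fl≡k = forces²-sound es i l k h in ¬mono (≡-all fi≡k fj≡k fl≡k)
  derive-sound es (notMono i j l) k 2F ¬mono h fl≡k =
    let fi≡k , fj≡k = forces²-sound es i j k h in ¬mono (≡-all fi≡k fj≡k fl≡k)

  refutes-sound : ∀ Cs E r → All (Holds f) Cs → All Excludes E → ¬ T (refutes Cs E r)
  refutes-sound Cs E (split i r₀ r₁ r₂) hs es h
    with T-∧³⁻ (refutes _ _ r₀) (refutes _ _ r₁) h | f i in fi≡k
  ... | h₀ , _ , _ | 0F = refutes-sound Cs _ r₀ hs (assume-sound fi≡k es) h₀
  ... | _ , h₁ , _ | 1F = refutes-sound Cs _ r₁ hs (assume-sound fi≡k es) h₁
  ... | _ , _ , h₂ | 2F = refutes-sound Cs _ r₂ hs (assume-sound fi≡k es) h₂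
  refutes-sound Cs E (derive n k v ▸ r) hs es h with head (drop n Cs) in eq
  ... | just con = let hp , hr = T-∧⁻ (premises? E con k v) h in
    refutes-sound Cs _ r hs (derive-sound es con k v (All-head-drop n hs eq) hp ∷ es) hr
  refutes-sound Cs E (close i) hs es h = let h₀ , h₁₂ = T-∧⁻ (excludes? E i 0F) h in
    excludes-sound es i 0F h₀ (forces-sound es i 0F h₁₂)

-- Points outside the list get the junk value 0ℚ, which no valid constraint accepts.
point : List ℚ → ℕ → ℚ
point P i = fromMaybe 0ℚ (head (drop i P))

IsSolution : ℚ → ℚ → ℚ → Set
IsSolution x₀ x₁ x₂ = x₀ ≢ 0ℚ × x₁ ≢ 0ℚ × x₂ ≢ 0ℚ × x₀ + three/two * x₁ ≡ nine/four * x₂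

solution? : ∀ x₀ x₁ x₂ → Dec (IsSolution x₀ x₁ x₂)
solution? x₀ x₁ x₂ =
  ¬? (x₀ ℚ.≟ 0ℚ) ×-dec ¬? (x₁ ℚ.≟ 0ℚ) ×-dec ¬? (x₂ ℚ.≟ 0ℚ) ×-dec x₀ + three/two * x₁ ℚ.≟ nine/four * x₂

*-solution : ∀ {x₀ x₁ x₂ y} → y ≢ 0ℚ → IsSolution x₀ x₁ x₂ → IsSolution (x₀ * y) (x₁ * y) (x₂ * y)
*-solution {x₀} {x₁} {x₂} {y} y≢0 (x₀≢0 , x₁≢0 , x₂≢0 , eq) =
  *-≢0 x₀≢0 y≢0 , *-≢0 x₁≢0 y≢0 , *-≢0 x₂≢0 y≢0 , (begin
    x₀ * y + three/two * (x₁ * y) ≡⟨ cong (λ z → x₀ * y + z) (ℚ.*-assoc three/two x₁ y) ⟨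
    x₀ * y + three/two * x₁ * y   ≡⟨ ℚ.*-distribʳ-+ y x₀ (three/two * x₁) ⟨
    (x₀ + three/two * x₁) * y     ≡⟨ cong (_* y) eq ⟩
    nine/four * x₂ * y            ≡⟨ ℚ.*-assoc nine/four x₂ y ⟩
    nine/four * (x₂ * y)          ∎)
  where open ≡-Reasoning

-- same never counts as valid: it only occurs as the hypothesis being refuted.
Valid : List ℚ → Constraint → Set
Valid P (distinct i j)  = point P i ≢ 0ℚ × point P j ≡ (+ 2) / 1 * point P i
Valid P (same i j)      = ⊥
Valid P (notMono i j l) = IsSolution (point P i) (point P j) (point P l)

valid? : ∀ P con → Dec (Valid P con)
valid? P (distinct i j)  = ¬? (point P i ℚ.≟ 0ℚ) ×-dec point P j ℚ.≟ (+ 2) / 1 * point P i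
valid? P (same i j)      = no id
valid? P (notMono i j l) = solution? (point P i) (point P j) (point P l)

-- Certificates: point 0 is 1, and constraint 0 of each refutation is the refuted hypothesis
-- relating points 0 and 1 (it is prepended by refuted).

points₄ : List ℚ
points₄ =
  (+ 1) / 1 ∷ (+ 4) / 1 ∷ (+ 1) / 2 ∷ (+ 3) / 2 ∷ (+ 5) / 3 ∷ (+ 2) / 1 ∷
  (+ 22) / 9 ∷ (+ 26) / 9 ∷ (+ 3) / 1 ∷ (+ 10) / 3 ∷ []

constraints₄ : List Constraint
constraints₄ =
  notMono 2 9 6 ∷ notMono 3 3 4 ∷ notMono 3 5 5 ∷ notMono 3 9 7 ∷
  notMono 3 1 9 ∷ notMono 5 4 5 ∷ notMono 5 8 7 ∷ notMono 8 2 4 ∷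
  notMono 8 4 6 ∷ notMono 8 8 9 ∷ notMono 8 1 1 ∷ notMono 1 0 6 ∷
  notMono 1 4 7 ∷ notMono 1 9 1 ∷ distinct 2 0 ∷ distinct 0 5 ∷
  distinct 3 8 ∷ distinct 4 9 ∷ []

refutation₄ : Refutation
refutation₄ =
  split 0
    (split 5
      (derive 16 0F 1F ▸ close 5)
      (split 8
        (derive 0 1F 1F ▸ derive 0 2F 1F ▸ derive 11 0F 0F ▸ close 8)
        (derive 0 1F 1F ▸ derive 0 2F 1F ▸ derive 3 1F 0F ▸ derive 6 1F 1F ▸ derive 7 1F 2F ▸
          derive 10 1F 2F ▸ derive 14 0F 1F ▸ derive 18 2F 0F ▸ derive 13 0F 2F ▸ derive 4 2F 0F ▸
          derive 2 0F 2F ▸ close 4)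
        (derive 0 1F 1F ▸ derive 0 2F 1F ▸ derive 12 0F 2F ▸ derive 15 0F 0F ▸ derive 3 1F 0F ▸
          derive 6 1F 1F ▸ derive 10 2F 2F ▸ derive 17 2F 0F ▸ derive 5 0F 2F ▸ derive 2 0F 2F ▸
          derive 8 2F 1F ▸ derive 9 2F 2F ▸ derive 1 1F 0F ▸ close 2))
      (split 8
        (derive 0 1F 1F ▸ derive 0 2F 1F ▸ derive 11 0F 0F ▸ close 8)
        (derive 0 1F 1F ▸ derive 0 2F 1F ▸ derive 12 0F 2F ▸ derive 15 0F 0F ▸ derive 3 2F 0F ▸
          derive 6 2F 1F ▸ derive 10 1F 2F ▸ derive 17 1F 0F ▸ derive 5 0F 2F ▸ derive 2 0F 2F ▸
          derive 8 1F 1F ▸ derive 9 1F 2F ▸ derive 1 2F 0F ▸ close 2)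
        (derive 0 1F 1F ▸ derive 0 2F 1F ▸ derive 3 2F 0F ▸ derive 6 2F 1F ▸ derive 7 2F 2F ▸
          derive 10 2F 2F ▸ derive 14 0F 1F ▸ derive 18 1F 0F ▸ derive 13 0F 2F ▸ derive 4 1F 0F ▸
          derive 2 0F 2F ▸ close 4)))
    (split 5
      (split 8
        (derive 0 0F 1F ▸ derive 0 2F 1F ▸ derive 3 0F 0F ▸ derive 6 0F 1F ▸ derive 7 0F 2F ▸
          derive 10 0F 2F ▸ derive 14 1F 1F ▸ derive 18 2F 0F ▸ derive 13 1F 2F ▸ derive 4 2F 0F ▸
          derive 2 1F 2F ▸ close 4)
        (derive 0 0F 1F ▸ derive 0 2F 1F ▸ derive 11 1F 0F ▸ close 8)
        (derive 0 0F 1F ▸ derive 0 2F 1F ▸ derive 12 1F 2F ▸ derive 15 1F 0F ▸ derive 3 0F 0F ▸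
          derive 6 0F 1F ▸ derive 10 2F 2F ▸ derive 17 2F 0F ▸ derive 5 1F 2F ▸ derive 2 1F 2F ▸
          derive 8 2F 1F ▸ derive 9 2F 2F ▸ derive 1 0F 0F ▸ close 2))
      (derive 16 1F 1F ▸ close 5)
      (split 8
        (derive 0 0F 1F ▸ derive 0 2F 1F ▸ derive 12 1F 2F ▸ derive 15 1F 0F ▸ derive 3 2F 0F ▸
          derive 6 2F 1F ▸ derive 10 0F 2F ▸ derive 17 0F 0F ▸ derive 5 1F 2F ▸ derive 2 1F 2F ▸
          derive 8 0F 1F ▸ derive 9 0F 2F ▸ derive 1 2F 0F ▸ close 2)
        (derive 0 0F 1F ▸ derive 0 2F 1F ▸ derive 11 1F 0F ▸ close 8)
        (derive 0 0F 1F ▸ derive 0 2F 1F ▸ derive 3 2F 0F ▸ derive 6 2F 1F ▸ derive 7 2F 2F ▸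
          derive 10 2F 2F ▸ derive 14 1F 1F ▸ derive 18 0F 0F ▸ derive 13 1F 2F ▸ derive 4 0F 0F ▸
          derive 2 1F 2F ▸ close 4)))
    (split 5
      (split 8
        (derive 0 0F 1F ▸ derive 0 1F 1F ▸ derive 3 0F 0F ▸ derive 6 0F 1F ▸ derive 7 0F 2F ▸
          derive 10 0F 2F ▸ derive 14 2F 1F ▸ derive 18 1F 0F ▸ derive 13 2F 2F ▸ derive 4 1F 0F ▸
          derive 2 2F 2F ▸ close 4)
        (derive 0 0F 1F ▸ derive 0 1F 1F ▸ derive 12 2F 2F ▸ derive 15 2F 0F ▸ derive 3 0F 0F ▸
          derive 6 0F 1F ▸ derive 10 1F 2F ▸ derive 17 1F 0F ▸ derive 5 2F 2F ▸ derive 2 2F 2F ▸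
          derive 8 1F 1F ▸ derive 9 1F 2F ▸ derive 1 0F 0F ▸ close 2)
        (derive 0 0F 1F ▸ derive 0 1F 1F ▸ derive 11 2F 0F ▸ close 8))
      (split 8
        (derive 0 0F 1F ▸ derive 0 1F 1F ▸ derive 12 2F 2F ▸ derive 15 2F 0F ▸ derive 3 1F 0F ▸
          derive 6 1F 1F ▸ derive 10 0F 2F ▸ derive 17 0F 0F ▸ derive 5 2F 2F ▸ derive 2 2F 2F ▸
          derive 8 0F 1F ▸ derive 9 0F 2F ▸ derive 1 1F 0F ▸ close 2)
        (derive 0 0F 1F ▸ derive 0 1F 1F ▸ derive 3 1F 0F ▸ derive 6 1F 1F ▸ derive 7 1F 2F ▸
          derive 10 1F 2F ▸ derive 14 2F 1F ▸ derive 18 0F 0F ▸ derive 13 2F 2F ▸ derive 4 0F 0F ▸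
          derive 2 2F 2F ▸ close 4)
        (derive 0 0F 1F ▸ derive 0 1F 1F ▸ derive 11 2F 0F ▸ close 8))
      (derive 16 2F 1F ▸ close 5))

points₃ : List ℚ
points₃ =
  (+ 1) / 1 ∷ (+ 3) / 1 ∷ (+ 1) / 2 ∷ (+ 3) / 2 ∷ (+ 5) / 3 ∷ (+ 2) / 1 ∷
  (+ 22) / 9 ∷ (+ 8) / 3 ∷ (+ 26) / 9 ∷ (+ 10) / 3 ∷ (+ 4) / 1 ∷ []

constraints₃ : List Constraint
constraints₃ =
  notMono 2 9 6 ∷ notMono 0 9 7 ∷ notMono 3 3 4 ∷ notMono 3 5 5 ∷
  notMono 3 9 8 ∷ notMono 3 10 9 ∷ notMono 4 8 7 ∷ notMono 5 4 5 ∷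
  notMono 5 1 8 ∷ notMono 1 2 4 ∷ notMono 1 4 6 ∷ notMono 1 5 7 ∷
  notMono 1 1 9 ∷ notMono 1 10 10 ∷ notMono 10 0 6 ∷ notMono 10 4 8 ∷
  notMono 10 9 10 ∷ distinct 2 0 ∷ distinct 0 5 ∷ distinct 3 1 ∷
  distinct 4 9 ∷ distinct 5 10 ∷ []

refutation₃ : Refutation
refutation₃ =
  split 0
    (split 5
      (derive 19 0F 1F ▸ close 5)
      (split 10
        (split 1
          (derive 0 0F 1F ▸ close 1)
          (derive 4 1F 0F ▸ derive 8 1F 1F ▸ derive 9 1F 2F ▸ derive 13 1F 2F ▸ derive 17 0F 1F ▸
            derive 21 2F 0F ▸ derive 16 0F 2F ▸ derive 5 2F 0F ▸ derive 3 0F 2F ▸ close 4)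
          (derive 15 0F 2F ▸ derive 18 0F 0F ▸ derive 4 1F 0F ▸ derive 8 1F 1F ▸ derive 13 2F 2F ▸
            derive 20 2F 0F ▸ derive 6 0F 2F ▸ derive 3 0F 2F ▸ derive 10 2F 1F ▸ derive 11 2F 2F ▸
            derive 1 1F 0F ▸ close 2))
        (derive 22 1F 1F ▸ close 10)
        (derive 0 0F 1F ▸ derive 4 1F 0F ▸ derive 8 1F 1F ▸ derive 14 2F 0F ▸ derive 17 2F 1F ▸
          derive 9 1F 2F ▸ derive 12 1F 2F ▸ derive 13 1F 2F ▸ derive 21 0F 0F ▸ derive 2 0F 2F ▸
          derive 7 2F 1F ▸ derive 5 0F 0F ▸ derive 3 2F 2F ▸ close 4))
      (split 10
        (split 1
          (derive 0 0F 1F ▸ close 1)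
          (derive 15 0F 2F ▸ derive 18 0F 0F ▸ derive 4 2F 0F ▸ derive 8 2F 1F ▸ derive 13 1F 2F ▸
            derive 20 1F 0F ▸ derive 6 0F 2F ▸ derive 3 0F 2F ▸ derive 10 1F 1F ▸ derive 11 1F 2F ▸
            derive 1 2F 0F ▸ close 2)
          (derive 4 2F 0F ▸ derive 8 2F 1F ▸ derive 9 2F 2F ▸ derive 13 2F 2F ▸ derive 17 0F 1F ▸
            derive 21 1F 0F ▸ derive 16 0F 2F ▸ derive 5 1F 0F ▸ derive 3 0F 2F ▸ close 4))
        (derive 0 0F 1F ▸ derive 4 2F 0F ▸ derive 8 2F 1F ▸ derive 14 1F 0F ▸ derive 17 1F 1F ▸
          derive 9 2F 2F ▸ derive 12 2F 2F ▸ derive 13 2F 2F ▸ derive 21 0F 0F ▸ derive 2 0F 2F ▸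
          derive 7 1F 1F ▸ derive 5 0F 0F ▸ derive 3 1F 2F ▸ close 4)
        (derive 22 2F 1F ▸ close 10)))
    (split 5
      (split 10
        (derive 22 0F 1F ▸ close 10)
        (split 1
          (derive 4 0F 0F ▸ derive 8 0F 1F ▸ derive 9 0F 2F ▸ derive 13 0F 2F ▸ derive 17 1F 1F ▸
            derive 21 2F 0F ▸ derive 16 1F 2F ▸ derive 5 2F 0F ▸ derive 3 1F 2F ▸ close 4)
          (derive 0 1F 1F ▸ close 1)
          (derive 15 1F 2F ▸ derive 18 1F 0F ▸ derive 4 0F 0F ▸ derive 8 0F 1F ▸ derive 13 2F 2F ▸
            derive 20 2F 0F ▸ derive 6 1F 2F ▸ derive 3 1F 2F ▸ derive 10 2F 1F ▸ derive 11 2F 2F ▸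
            derive 1 0F 0F ▸ close 2))
        (derive 0 1F 1F ▸ derive 4 0F 0F ▸ derive 8 0F 1F ▸ derive 14 2F 0F ▸ derive 17 2F 1F ▸
          derive 9 0F 2F ▸ derive 12 0F 2F ▸ derive 13 0F 2F ▸ derive 21 1F 0F ▸ derive 2 1F 2F ▸
          derive 7 2F 1F ▸ derive 5 1F 0F ▸ derive 3 2F 2F ▸ close 4))
      (derive 19 1F 1F ▸ close 5)
      (split 10
        (derive 0 1F 1F ▸ derive 4 2F 0F ▸ derive 8 2F 1F ▸ derive 14 0F 0F ▸ derive 17 0F 1F ▸
          derive 9 2F 2F ▸ derive 12 2F 2F ▸ derive 13 2F 2F ▸ derive 21 1F 0F ▸ derive 2 1F 2F ▸
          derive 7 0F 1F ▸ derive 5 1F 0F ▸ derive 3 0F 2F ▸ close 4)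
        (split 1
          (derive 15 1F 2F ▸ derive 18 1F 0F ▸ derive 4 2F 0F ▸ derive 8 2F 1F ▸ derive 13 0F 2F ▸
            derive 20 0F 0F ▸ derive 6 1F 2F ▸ derive 3 1F 2F ▸ derive 10 0F 1F ▸ derive 11 0F 2F ▸
            derive 1 2F 0F ▸ close 2)
          (derive 0 1F 1F ▸ close 1)
          (derive 4 2F 0F ▸ derive 8 2F 1F ▸ derive 9 2F 2F ▸ derive 13 2F 2F ▸ derive 17 1F 1F ▸
            derive 21 0F 0F ▸ derive 16 1F 2F ▸ derive 5 0F 0F ▸ derive 3 1F 2F ▸ close 4))
        (derive 22 2F 1F ▸ close 10)))
    (split 5
      (split 10
        (derive 22 0F 1F ▸ close 10)
        (derive 0 2F 1F ▸ derive 4 0F 0F ▸ derive 8 0F 1F ▸ derive 14 1F 0F ▸ derive 17 1F 1F ▸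
          derive 9 0F 2F ▸ derive 12 0F 2F ▸ derive 13 0F 2F ▸ derive 21 2F 0F ▸ derive 2 2F 2F ▸
          derive 7 1F 1F ▸ derive 5 2F 0F ▸ derive 3 1F 2F ▸ close 4)
        (split 1
          (derive 4 0F 0F ▸ derive 8 0F 1F ▸ derive 9 0F 2F ▸ derive 13 0F 2F ▸ derive 17 2F 1F ▸
            derive 21 1F 0F ▸ derive 16 2F 2F ▸ derive 5 1F 0F ▸ derive 3 2F 2F ▸ close 4)
          (derive 15 2F 2F ▸ derive 18 2F 0F ▸ derive 4 0F 0F ▸ derive 8 0F 1F ▸ derive 13 1F 2F ▸
            derive 20 1F 0F ▸ derive 6 2F 2F ▸ derive 3 2F 2F ▸ derive 10 1F 1F ▸ derive 11 1F 2F ▸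
            derive 1 0F 0F ▸ close 2)
          (derive 0 2F 1F ▸ close 1)))
      (split 10
        (derive 0 2F 1F ▸ derive 4 1F 0F ▸ derive 8 1F 1F ▸ derive 14 0F 0F ▸ derive 17 0F 1F ▸
          derive 9 1F 2F ▸ derive 12 1F 2F ▸ derive 13 1F 2F ▸ derive 21 2F 0F ▸ derive 2 2F 2F ▸
          derive 7 0F 1F ▸ derive 5 2F 0F ▸ derive 3 0F 2F ▸ close 4)
        (derive 22 1F 1F ▸ close 10)
        (split 1
          (derive 15 2F 2F ▸ derive 18 2F 0F ▸ derive 4 1F 0F ▸ derive 8 1F 1F ▸ derive 13 0F 2F ▸
            derive 20 0F 0F ▸ derive 6 2F 2F ▸ derive 3 2F 2F ▸ derive 10 0F 1F ▸ derive 11 0F 2F ▸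
            derive 1 1F 0F ▸ close 2)
          (derive 4 1F 0F ▸ derive 8 1F 1F ▸ derive 9 1F 2F ▸ derive 13 1F 2F ▸ derive 17 2F 1F ▸
            derive 21 0F 0F ▸ derive 16 2F 2F ▸ derive 5 0F 0F ▸ derive 3 2F 2F ▸ close 4)
          (derive 0 2F 1F ▸ close 1)))
      (derive 19 2F 1F ▸ close 5))

points₅ : List ℚ
points₅ =
  (+ 1) / 1 ∷ (+ 5) / 1 ∷ -[1+ 0 ] / 2 ∷ (+ 1) / 2 ∷ (+ 3) / 4 ∷ (+ 5) / 6 ∷
  (+ 5) / 4 ∷ (+ 3) / 2 ∷ (+ 5) / 3 ∷ (+ 2) / 1 ∷ (+ 22) / 9 ∷ (+ 5) / 2 ∷
  (+ 21) / 8 ∷ (+ 25) / 9 ∷ (+ 26) / 9 ∷ (+ 3) / 1 ∷ (+ 10) / 3 ∷ (+ 7) / 2 ∷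
  (+ 15) / 4 ∷ (+ 4) / 1 ∷ (+ 21) / 4 ∷ (+ 17) / 3 ∷ (+ 27) / 4 ∷ []

constraints₅ : List Constraint
constraints₅ =
  notMono 2 16 9 ∷ notMono 2 19 10 ∷ notMono 3 16 10 ∷ notMono 3 21 19 ∷
  notMono 4 4 5 ∷ notMono 4 0 0 ∷ notMono 0 5 0 ∷ notMono 0 15 10 ∷
  notMono 0 17 13 ∷ notMono 6 8 8 ∷ notMono 6 16 13 ∷ notMono 7 6 7 ∷
  notMono 7 7 8 ∷ notMono 7 9 9 ∷ notMono 7 16 14 ∷ notMono 7 19 16 ∷
  notMono 7 1 19 ∷ notMono 9 8 9 ∷ notMono 9 15 14 ∷ notMono 11 5 8 ∷
  notMono 12 2 5 ∷ notMono 12 22 21 ∷ notMono 15 2 0 ∷ notMono 15 3 8 ∷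
  notMono 15 8 10 ∷ notMono 15 11 15 ∷ notMono 15 15 16 ∷ notMono 15 19 19 ∷
  notMono 18 8 13 ∷ notMono 18 17 19 ∷ notMono 18 1 1 ∷ notMono 19 0 10 ∷
  notMono 19 7 13 ∷ notMono 19 8 14 ∷ notMono 19 16 19 ∷ notMono 20 0 15 ∷
  notMono 20 11 19 ∷ notMono 20 1 21 ∷ notMono 22 4 17 ∷ notMono 22 7 19 ∷
  distinct 3 0 ∷ distinct 4 7 ∷ distinct 0 9 ∷ distinct 7 15 ∷
  distinct 8 16 ∷ distinct 9 19 ∷ distinct 11 1 ∷ distinct 12 20 ∷
  []

refutation₅ : Refutation
refutation₅ =
  split 0
    (split 9
      (derive 43 0F 1F ▸ close 9)
      (split 19
        (split 15
          (derive 28 0F 0F ▸ close 15)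
          (derive 14 1F 0F ▸ derive 18 1F 1F ▸ derive 19 1F 2F ▸ derive 27 1F 2F ▸ derive 35 0F 1F ▸
            derive 45 2F 0F ▸ derive 34 0F 2F ▸ derive 15 2F 0F ▸ derive 13 0F 2F ▸ close 8)
          (derive 32 0F 2F ▸ derive 41 0F 0F ▸ derive 14 1F 0F ▸ derive 18 1F 1F ▸ derive 27 2F 2F ▸
            derive 44 2F 0F ▸ derive 16 0F 2F ▸ derive 13 0F 2F ▸ derive 24 2F 1F ▸
            derive 25 2F 2F ▸ derive 3 1F 0F ▸ close 3))
        (derive 46 1F 1F ▸ close 19)
        (split 15
          (derive 0 0F 1F ▸ derive 6 0F 0F ▸ derive 7 0F 1F ▸ derive 8 0F 2F ▸ derive 23 0F 1F ▸
            derive 36 0F 0F ▸ derive 41 0F 0F ▸ derive 14 1F 0F ▸ derive 18 1F 1F ▸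
            derive 26 0F 1F ▸ derive 27 0F 2F ▸ derive 44 0F 0F ▸ derive 16 2F 2F ▸
            derive 17 2F 1F ▸ derive 33 2F 2F ▸ derive 40 2F 0F ▸ derive 31 1F 0F ▸
            derive 47 1F 0F ▸ derive 42 2F 0F ▸ derive 5 1F 2F ▸ derive 20 2F 2F ▸ derive 1 1F 0F ▸
            derive 2 2F 2F ▸ derive 21 2F 0F ▸ derive 37 2F 0F ▸ derive 38 1F 2F ▸
            derive 48 1F 0F ▸ derive 3 1F 0F ▸ derive 4 2F 1F ▸ derive 12 2F 1F ▸ derive 10 0F 0F ▸
            derive 11 1F 2F ▸ derive 9 0F 1F ▸ derive 29 0F 0F ▸ derive 22 0F 1F ▸
            derive 39 1F 2F ▸ derive 30 2F 0F ▸ close 18)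
          (derive 14 1F 0F ▸ derive 18 1F 1F ▸ derive 19 1F 2F ▸ derive 27 1F 2F ▸ derive 35 2F 1F ▸
            derive 45 0F 0F ▸ derive 34 2F 2F ▸ derive 15 0F 0F ▸ derive 13 2F 2F ▸ close 8)
          (derive 28 2F 0F ▸ close 15)))
      (split 19
        (split 15
          (derive 28 0F 0F ▸ close 15)
          (derive 32 0F 2F ▸ derive 41 0F 0F ▸ derive 14 2F 0F ▸ derive 18 2F 1F ▸ derive 27 1F 2F ▸
            derive 44 1F 0F ▸ derive 16 0F 2F ▸ derive 13 0F 2F ▸ derive 24 1F 1F ▸
            derive 25 1F 2F ▸ derive 3 2F 0F ▸ close 3)
          (derive 14 2F 0F ▸ derive 18 2F 1F ▸ derive 19 2F 2F ▸ derive 27 2F 2F ▸ derive 35 0F 1F ▸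
            derive 45 1F 0F ▸ derive 34 0F 2F ▸ derive 15 1F 0F ▸ derive 13 0F 2F ▸ close 8))
        (split 15
          (derive 0 0F 1F ▸ derive 6 0F 0F ▸ derive 7 0F 1F ▸ derive 8 0F 2F ▸ derive 23 0F 1F ▸
            derive 36 0F 0F ▸ derive 41 0F 0F ▸ derive 14 2F 0F ▸ derive 18 2F 1F ▸
            derive 26 0F 1F ▸ derive 27 0F 2F ▸ derive 44 0F 0F ▸ derive 16 1F 2F ▸
            derive 17 1F 1F ▸ derive 33 1F 2F ▸ derive 40 1F 0F ▸ derive 31 2F 0F ▸
            derive 47 2F 0F ▸ derive 42 1F 0F ▸ derive 5 2F 2F ▸ derive 20 1F 2F ▸ derive 1 2F 0F ▸
            derive 2 1F 2F ▸ derive 21 1F 0F ▸ derive 37 1F 0F ▸ derive 38 2F 2F ▸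
            derive 48 2F 0F ▸ derive 3 2F 0F ▸ derive 4 1F 1F ▸ derive 12 1F 1F ▸ derive 10 0F 0F ▸
            derive 11 2F 2F ▸ derive 9 0F 1F ▸ derive 29 0F 0F ▸ derive 22 0F 1F ▸
            derive 39 2F 2F ▸ derive 30 1F 0F ▸ close 18)
          (derive 28 1F 0F ▸ close 15)
          (derive 14 2F 0F ▸ derive 18 2F 1F ▸ derive 19 2F 2F ▸ derive 27 2F 2F ▸ derive 35 1F 1F ▸
            derive 45 0F 0F ▸ derive 34 1F 2F ▸ derive 15 0F 0F ▸ derive 13 1F 2F ▸ close 8))
        (derive 46 2F 1F ▸ close 19)))
    (split 9
      (split 19
        (derive 46 0F 1F ▸ close 19)
        (split 15
          (derive 14 0F 0F ▸ derive 18 0F 1F ▸ derive 19 0F 2F ▸ derive 27 0F 2F ▸ derive 35 1F 1F ▸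
            derive 45 2F 0F ▸ derive 34 1F 2F ▸ derive 15 2F 0F ▸ derive 13 1F 2F ▸ close 8)
          (derive 28 1F 0F ▸ close 15)
          (derive 32 1F 2F ▸ derive 41 1F 0F ▸ derive 14 0F 0F ▸ derive 18 0F 1F ▸ derive 27 2F 2F ▸
            derive 44 2F 0F ▸ derive 16 1F 2F ▸ derive 13 1F 2F ▸ derive 24 2F 1F ▸
            derive 25 2F 2F ▸ derive 3 0F 0F ▸ close 3))
        (split 15
          (derive 14 0F 0F ▸ derive 18 0F 1F ▸ derive 19 0F 2F ▸ derive 27 0F 2F ▸ derive 35 2F 1F ▸
            derive 45 1F 0F ▸ derive 34 2F 2F ▸ derive 15 1F 0F ▸ derive 13 2F 2F ▸ close 8)
          (derive 0 1F 1F ▸ derive 6 1F 0F ▸ derive 7 1F 1F ▸ derive 8 1F 2F ▸ derive 23 1F 1F ▸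
            derive 36 1F 0F ▸ derive 41 1F 0F ▸ derive 14 0F 0F ▸ derive 18 0F 1F ▸
            derive 26 1F 1F ▸ derive 27 1F 2F ▸ derive 44 1F 0F ▸ derive 16 2F 2F ▸
            derive 17 2F 1F ▸ derive 33 2F 2F ▸ derive 40 2F 0F ▸ derive 31 0F 0F ▸
            derive 47 0F 0F ▸ derive 42 2F 0F ▸ derive 5 0F 2F ▸ derive 20 2F 2F ▸ derive 1 0F 0F ▸
            derive 2 2F 2F ▸ derive 21 2F 0F ▸ derive 37 2F 0F ▸ derive 38 0F 2F ▸
            derive 48 0F 0F ▸ derive 3 0F 0F ▸ derive 4 2F 1F ▸ derive 12 2F 1F ▸ derive 10 1F 0F ▸
            derive 11 0F 2F ▸ derive 9 1F 1F ▸ derive 29 1F 0F ▸ derive 22 1F 1F ▸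
            derive 39 0F 2F ▸ derive 30 2F 0F ▸ close 18)
          (derive 28 2F 0F ▸ close 15)))
      (derive 43 1F 1F ▸ close 9)
      (split 19
        (split 15
          (derive 28 0F 0F ▸ close 15)
          (derive 0 1F 1F ▸ derive 6 1F 0F ▸ derive 7 1F 1F ▸ derive 8 1F 2F ▸ derive 23 1F 1F ▸
            derive 36 1F 0F ▸ derive 41 1F 0F ▸ derive 14 2F 0F ▸ derive 18 2F 1F ▸
            derive 26 1F 1F ▸ derive 27 1F 2F ▸ derive 44 1F 0F ▸ derive 16 0F 2F ▸
            derive 17 0F 1F ▸ derive 33 0F 2F ▸ derive 40 0F 0F ▸ derive 31 2F 0F ▸
            derive 47 2F 0F ▸ derive 42 0F 0F ▸ derive 5 2F 2F ▸ derive 20 0F 2F ▸ derive 1 2F 0F ▸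
            derive 2 0F 2F ▸ derive 21 0F 0F ▸ derive 37 0F 0F ▸ derive 38 2F 2F ▸
            derive 48 2F 0F ▸ derive 3 2F 0F ▸ derive 4 0F 1F ▸ derive 12 0F 1F ▸ derive 10 1F 0F ▸
            derive 11 2F 2F ▸ derive 9 1F 1F ▸ derive 29 1F 0F ▸ derive 22 1F 1F ▸
            derive 39 2F 2F ▸ derive 30 0F 0F ▸ close 18)
          (derive 14 2F 0F ▸ derive 18 2F 1F ▸ derive 19 2F 2F ▸ derive 27 2F 2F ▸ derive 35 0F 1F ▸
            derive 45 1F 0F ▸ derive 34 0F 2F ▸ derive 15 1F 0F ▸ derive 13 0F 2F ▸ close 8))
        (split 15
          (derive 32 1F 2F ▸ derive 41 1F 0F ▸ derive 14 2F 0F ▸ derive 18 2F 1F ▸ derive 27 0F 2F ▸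
            derive 44 0F 0F ▸ derive 16 1F 2F ▸ derive 13 1F 2F ▸ derive 24 0F 1F ▸
            derive 25 0F 2F ▸ derive 3 2F 0F ▸ close 3)
          (derive 28 1F 0F ▸ close 15)
          (derive 14 2F 0F ▸ derive 18 2F 1F ▸ derive 19 2F 2F ▸ derive 27 2F 2F ▸ derive 35 1F 1F ▸
            derive 45 0F 0F ▸ derive 34 1F 2F ▸ derive 15 0F 0F ▸ derive 13 1F 2F ▸ close 8))
        (derive 46 2F 1F ▸ close 19)))
    (split 9
      (split 19
        (derive 46 0F 1F ▸ close 19)
        (split 15
          (derive 14 0F 0F ▸ derive 18 0F 1F ▸ derive 19 0F 2F ▸ derive 27 0F 2F ▸ derive 35 1F 1F ▸
            derive 45 2F 0F ▸ derive 34 1F 2F ▸ derive 15 2F 0F ▸ derive 13 1F 2F ▸ close 8)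
          (derive 28 1F 0F ▸ close 15)
          (derive 0 2F 1F ▸ derive 6 2F 0F ▸ derive 7 2F 1F ▸ derive 8 2F 2F ▸ derive 23 2F 1F ▸
            derive 36 2F 0F ▸ derive 41 2F 0F ▸ derive 14 0F 0F ▸ derive 18 0F 1F ▸
            derive 26 2F 1F ▸ derive 27 2F 2F ▸ derive 44 2F 0F ▸ derive 16 1F 2F ▸
            derive 17 1F 1F ▸ derive 33 1F 2F ▸ derive 40 1F 0F ▸ derive 31 0F 0F ▸
            derive 47 0F 0F ▸ derive 42 1F 0F ▸ derive 5 0F 2F ▸ derive 20 1F 2F ▸ derive 1 0F 0F ▸
            derive 2 1F 2F ▸ derive 21 1F 0F ▸ derive 37 1F 0F ▸ derive 38 0F 2F ▸
            derive 48 0F 0F ▸ derive 3 0F 0F ▸ derive 4 1F 1F ▸ derive 12 1F 1F ▸ derive 10 2F 0F ▸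
            derive 11 0F 2F ▸ derive 9 2F 1F ▸ derive 29 2F 0F ▸ derive 22 2F 1F ▸
            derive 39 0F 2F ▸ derive 30 1F 0F ▸ close 18))
        (split 15
          (derive 14 0F 0F ▸ derive 18 0F 1F ▸ derive 19 0F 2F ▸ derive 27 0F 2F ▸ derive 35 2F 1F ▸
            derive 45 1F 0F ▸ derive 34 2F 2F ▸ derive 15 1F 0F ▸ derive 13 2F 2F ▸ close 8)
          (derive 32 2F 2F ▸ derive 41 2F 0F ▸ derive 14 0F 0F ▸ derive 18 0F 1F ▸ derive 27 1F 2F ▸
            derive 44 1F 0F ▸ derive 16 2F 2F ▸ derive 13 2F 2F ▸ derive 24 1F 1F ▸
            derive 25 1F 2F ▸ derive 3 0F 0F ▸ close 3)
          (derive 28 2F 0F ▸ close 15)))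
      (split 19
        (split 15
          (derive 28 0F 0F ▸ close 15)
          (derive 14 1F 0F ▸ derive 18 1F 1F ▸ derive 19 1F 2F ▸ derive 27 1F 2F ▸ derive 35 0F 1F ▸
            derive 45 2F 0F ▸ derive 34 0F 2F ▸ derive 15 2F 0F ▸ derive 13 0F 2F ▸ close 8)
          (derive 0 2F 1F ▸ derive 6 2F 0F ▸ derive 7 2F 1F ▸ derive 8 2F 2F ▸ derive 23 2F 1F ▸
            derive 36 2F 0F ▸ derive 41 2F 0F ▸ derive 14 1F 0F ▸ derive 18 1F 1F ▸
            derive 26 2F 1F ▸ derive 27 2F 2F ▸ derive 44 2F 0F ▸ derive 16 0F 2F ▸
            derive 17 0F 1F ▸ derive 33 0F 2F ▸ derive 40 0F 0F ▸ derive 31 1F 0F ▸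
            derive 47 1F 0F ▸ derive 42 0F 0F ▸ derive 5 1F 2F ▸ derive 20 0F 2F ▸ derive 1 1F 0F ▸
            derive 2 0F 2F ▸ derive 21 0F 0F ▸ derive 37 0F 0F ▸ derive 38 1F 2F ▸
            derive 48 1F 0F ▸ derive 3 1F 0F ▸ derive 4 0F 1F ▸ derive 12 0F 1F ▸ derive 10 2F 0F ▸
            derive 11 1F 2F ▸ derive 9 2F 1F ▸ derive 29 2F 0F ▸ derive 22 2F 1F ▸
            derive 39 1F 2F ▸ derive 30 0F 0F ▸ close 18))
        (derive 46 1F 1F ▸ close 19)
        (split 15
          (derive 32 2F 2F ▸ derive 41 2F 0F ▸ derive 14 1F 0F ▸ derive 18 1F 1F ▸ derive 27 0F 2F ▸
            derive 44 0F 0F ▸ derive 16 2F 2F ▸ derive 13 2F 2F ▸ derive 24 0F 1F ▸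
            derive 25 0F 2F ▸ derive 3 1F 0F ▸ close 3)
          (derive 14 1F 0F ▸ derive 18 1F 1F ▸ derive 19 1F 2F ▸ derive 27 1F 2F ▸ derive 35 2F 1F ▸
            derive 45 0F 0F ▸ derive 34 2F 2F ▸ derive 15 0F 0F ▸ derive 13 2F 2F ▸ close 8)
          (derive 28 2F 0F ▸ close 15)))
      (derive 43 2F 1F ▸ close 9))

-- Colourings without monochromatic solutions

module Forced (c : Colouring) (no-mono : NoMonoSol c)
         (c≢c2 : ∀ x → x ≢ 0ℚ → c x ≢ c ((+ 2) / 1 * x)) where

  valid⇒holds : ∀ {P y} → y ≢ 0ℚ → ∀ con → Valid P con → Holds (λ i → c (point P i * y)) con
  valid⇒holds {P} {y} y≢0 (distinct i j) (pi≢0 , pj≡2pi) e =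
    c≢c2 (point P i * y) (*-≢0 pi≢0 y≢0)
      (trans e (cong c (trans (cong (_* y) pj≡2pi) (ℚ.*-assoc ((+ 2) / 1) (point P i) y))))
  valid⇒holds y≢0 (notMono i j l) sol (e₀ , e₁) =
    let x₀≢0 , x₁≢0 , x₂≢0 , eq = *-solution y≢0 sol in no-mono _ _ _ (x₀≢0 , x₁≢0 , x₂≢0 , eq , e₀ , e₁)

  refuted : ∀ {y} → y ≢ 0ℚ → ∀ P goal Cs r → T (isYes (all? (valid? P) Cs)) →
            T (refutes (goal ∷ Cs) [] r) → ¬ Holds (λ i → c (point P i * y)) goal
  refuted y≢0 P goal Cs r valid checks goal-holds =
    refutes-sound _ (goal ∷ Cs) [] r (goal-holds ∷ All.map (valid⇒holds y≢0 _) (toWitness valid)) [] checks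

  c≢c4 : ∀ x → x ≢ 0ℚ → c x ≢ c ((+ 4) / 1 * x)
  c≢c4 x x≢0 e =
    refuted x≢0 points₄ (same 0 1) constraints₄ refutation₄ _ _ (trans (cong c (ℚ.*-identityˡ x)) e)

  c3≡c : ∀ x → x ≢ 0ℚ → c ((+ 3) / 1 * x) ≡ c x
  c3≡c x x≢0 = decidable-stable (c _ ≟ c x) λ c3≢c →
    refuted x≢0 points₃ (distinct 0 1) constraints₃ refutation₃ _ _
      (λ e → c3≢c (trans (sym e) (cong c (ℚ.*-identityˡ x))))

  c5≡c : ∀ x → x ≢ 0ℚ → c ((+ 5) / 1 * x) ≡ c x
  c5≡c x x≢0 = decidable-stable (c _ ≟ c x) λ c5≢c →
    refuted x≢0 points₅ (distinct 0 1) constraints₅ refutation₅ _ _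
      (λ e → c5≢c (trans (sym e) (cong c (ℚ.*-identityˡ x))))

  c8≡c : ∀ x → x ≢ 0ℚ → c ((+ 8) / 1 * x) ≡ c x
  c8≡c x x≢0 = last-colour (c≢c2 x x≢0) (c≢c2 (2′ * x) 2x≢0 ∘ rescale 2′ 2′) (≢-sym (c≢c4 x x≢0))
                            (≢-sym (c≢c4 (2′ * x) 2x≢0 ∘ rescale 4′ 2′))
                            (≢-sym (c≢c2 (4′ * x) (*-≢0 {4′} (λ ()) x≢0) ∘ rescale 2′ 4′))
    where
      2′ 4′ : ℚ
      2′ = (+ 2) / 1
      4′ = (+ 4) / 1
      2x≢0 : 2′ * x ≢ 0ℚ
      2x≢0 = *-≢0 {2′} (λ ()) x≢0
      rescale : ∀ a b {z} → z ≡ c (a * b * x) → z ≡ c (a * (b * x))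
      rescale a b e = trans e (cong c (ℚ.*-assoc a b x))

lemma28 : (c : Colouring) → NoMonoSol c →
          (∀ x → x ≢ 0ℚ → c x ≢ c ((+ 2) / 1 * x)) →
          ∀ (y : ℚ) → y ≢ 0ℚ → ∀ (m n p : ℤ) →
          (c (zpow 1 m * zpow 2 n * zpow 4 p * y) ≡ c y) ⇔ (+ 3 ∣ m)
lemma28 c no-mono c≢c2 y y≢0 m n p = begin
    c (zpow 1 m * zpow 2 n * zpow 4 p * y) ≡ c y ∼⟨ ≡-cong-⇔ (cong c regroup) (sym cw≡cy) ⟩
    c (zpow 1 m * w) ≡ c w                       ∼⟨ powers-of-two c c≢c2 c≢c4 c8≡c m w w≢0 ⟩
    + 3 ∣ m                                      ∎
  where
    open EquationalReasoning
    open Forced c no-mono c≢c2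
    v = zpow 4 p * y
    w = zpow 2 n * v
    v≢0 = *-≢0 (zpow≢0 4 p) y≢0
    w≢0 = *-≢0 (zpow≢0 2 n) v≢0
    regroup : zpow 1 m * zpow 2 n * zpow 4 p * y ≡ zpow 1 m * w
    regroup = trans (ℚ.*-assoc (zpow 1 m * zpow 2 n) (zpow 4 p) y) (ℚ.*-assoc (zpow 1 m) (zpow 2 n) v)
    cw≡cy : c w ≡ c y
    cw≡cy = trans (zpow-invariant c 2 c3≡c n v v≢0) (zpow-invariant c 4 c5≡c p y y≢0)
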